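{- For every positive integer $n$ and every integer $c$ with $0\le c\le\binom{n}{2}$, there is a permutation $p\in S_n$ having exactly $c$ copies of the pattern $21$ and no copies of the pattern $132$.
   Context: A copy of a pattern $q\in S_l$ in $p=p_1\ldots p_n$ is a subsequence $p_{i_1}\ldots p_{i_l}$ ($i_1<\dots<i_l$) whose entries are in the same relative order as those of $q$; copies of $21$ are inversions. -}

module Defs where

open import Data.Nat using (ℕ; _+_)
open import Data.Fin using (Fin; _<_; _<?_)
open import Data.List using (List; length; filter; map; allFin)
open import Data.Nat.ListAction using (sum)
open import Data.Product using (_×_; _,_)
open import Relation.Nullary using (Dec; yes; no)
open import Relation.Nullary.Decidable using (_×-dec_)


-- A permutation p ∈ S_n is a bijection Fin n ⤖ Fin n (stdlib 'Permutation n n').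
-- Positions and values are both Fin n (0-based, order preserved).

count21 : {n : ℕ} → (Fin n → Fin n) → ℕ
count21 {n} p =
  sum (map (λ i → length (filter (λ j → (i <? j) ×-dec (p j <? p i)) (allFin n))) (allFin n))

count132 : {n : ℕ} → (Fin n → Fin n) → ℕ
count132 {n} p =
  sum (map (λ i → sum (map (λ j →
    length (filter (λ k → ((i <? j) ×-dec (j <? k)) ×-dec ((p i <? p k) ×-dec (p k <? p j)))
                   (allFin n)))
    (allFin n))) (allFin n))

-- The permutations are built by induction on n, always prepending a first value v to a
-- 132-avoiding permutation q of the remaining positions (values of q at least v shift up).
-- The new head creates exactly #{j | q j < v} inversions, and it starts no copy of 132
-- unless some later pair j < k has v < p k < p j. If c < n, take v = c and q the identity:
-- this gives c inversions, and the increasing tail has no inversions for the head to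
-- complete to a 132. Otherwise take v = n - 1, the maximum, which creates n - 1 inversions
-- and cannot be the 1 of a 132, and recurse with c - (n - 1) ≤ C(n - 1, 2) inversions;
-- this range is exactly right since C(n, 2) = (n - 1) + C(n - 1, 2).
module Submission where

open import Defs
open import Data.Nat using (ℕ; _≤_; NonZero)
open import Data.Nat.Combinatorics using (_C_)
open import Data.Product using (Σ; _×_)
open import Relation.Binary.PropositionalEquality using (_≡_)
open import Data.Fin.Permutation using (Permutation′; _⟨$⟩ʳ_)

open import Data.Bool using (true; false)
open import Data.Fin using (Fin; zero; suc; toℕ; fromℕ; fromℕ<; punchIn; _<_; _<?_)
open import Data.Fin.Permutation using (insert; id; insert-punchIn)
open import Data.Fin.Properties using (toℕ-fromℕ; toℕ-fromℕ<; punchIn-mono-≤; punchIn-cancel-≤)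
open import Data.List using (List; []; _∷_; length; filter; map; allFin)
open import Data.List.Properties
  using (map-tabulate; map-cong; filter-accept; filter-reject; filter-none; filter-≐)
open import Data.List.Relation.Unary.All using (universal)
open import Data.Nat using (zero; suc; _+_; _∸_; z<s; s<s; s<s⁻¹; _≤?_)
open import Data.Nat.Combinatorics using (nC1≡n; nCk+nC[k+1]≡[n+1]C[k+1])
open import Data.Nat.ListAction using (sum)
open import Data.Nat.Properties
  using (<-asym; ≰⇒>; <⇒≤; <⇒≱; n≤0⇒n≡0; +-identityʳ; m≤n+o⇒m∸n≤o; m+[n∸m]≡n)
open import Data.Product using (_,_)
open import Function using (_∘_)
open import Function.Bundles using (_⇔_; mk⇔; Equivalence)
open import Level using (Level)
open import Relation.Binary.PropositionalEquality
  using (refl; sym; trans; cong; cong₂; subst; module ≡-Reasoning)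
open import Relation.Nullary using (¬_; does; yes; no)
open import Relation.Nullary.Decidable using (_×-dec_)
open import Relation.Unary using (Pred; Decidable; _≐_)

open Equivalence using (to; from)

private
  variable
    a b ℓ ℓ′ : Level
    A : Set a
    B : Set b
    n : ℕ

length-filter-map : {P : Pred A ℓ} (P? : Decidable P) (f : B → A) (xs : List B) →
                    length (filter P? (map f xs)) ≡ length (filter (P? ∘ f) xs)
length-filter-map P? f []       = refl
length-filter-map P? f (x ∷ xs) with does (P? (f x))
... | true  = cong suc (length-filter-map P? f xs)
... | false = length-filter-map P? f xs

allFin-suc : ∀ n → allFin (suc n) ≡ zero ∷ map suc (allFin n)
allFin-suc n = cong (zero ∷_) (sym (map-tabulate (λ i → i) suc))

sumFin : (Fin n → ℕ) → ℕ
sumFin {n} h = sum (map h (allFin n))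

countFin : {P : Pred (Fin n) ℓ} → Decidable P → ℕ
countFin {n} P? = length (filter P? (allFin n))

sumFin-suc : (h : Fin (suc n) → ℕ) → sumFin h ≡ h zero + sumFin (h ∘ suc)
sumFin-suc {n} h =
  cong (h zero +_) (cong sum (trans (map-tabulate suc h) (sym (map-tabulate (λ i → i) (h ∘ suc)))))

sumFin-cong : {h k : Fin n → ℕ} → (∀ i → h i ≡ k i) → sumFin h ≡ sumFin k
sumFin-cong {n} h≗k = cong sum (map-cong h≗k (allFin n))

sumFin-zero : {h : Fin n → ℕ} → (∀ i → h i ≡ 0) → sumFin h ≡ 0
sumFin-zero {zero}  h≡0 = refl
sumFin-zero {suc n} {h} h≡0 =
  trans (sumFin-suc h) (cong₂ _+_ (h≡0 zero) (sumFin-zero (h≡0 ∘ suc)))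

countFin-cong : {P : Pred (Fin n) ℓ} {Q : Pred (Fin n) ℓ′} (P? : Decidable P) (Q? : Decidable Q) →
                P ≐ Q → countFin P? ≡ countFin Q?
countFin-cong {n} P? Q? P≐Q = cong length (filter-≐ P? Q? P≐Q (allFin n))

countFin-none : {P : Pred (Fin n) ℓ} (P? : Decidable P) → (∀ i → ¬ P i) → countFin P? ≡ 0
countFin-none {n} P? ¬P = cong length (filter-none P? (universal ¬P (allFin n)))

countFin-suc-reject : {P : Pred (Fin (suc n)) ℓ} (P? : Decidable P) →
                      ¬ P zero → countFin P? ≡ countFin (P? ∘ suc)
countFin-suc-reject {n} P? ¬P0 = begin
  length (filter P? (allFin (suc n)))            ≡⟨ cong (length ∘ filter P?) (allFin-suc n) ⟩
  length (filter P? (zero ∷ map suc (allFin n))) ≡⟨ cong length (filter-reject P? ¬P0) ⟩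
  length (filter P? (map suc (allFin n)))        ≡⟨ length-filter-map P? suc (allFin n) ⟩
  length (filter (P? ∘ suc) (allFin n))          ∎
  where open ≡-Reasoning

countFin-suc-accept : {P : Pred (Fin (suc n)) ℓ} (P? : Decidable P) →
                      P zero → countFin P? ≡ suc (countFin (P? ∘ suc))
countFin-suc-accept {n} P? P0 = begin
  length (filter P? (allFin (suc n)))            ≡⟨ cong (length ∘ filter P?) (allFin-suc n) ⟩
  length (filter P? (zero ∷ map suc (allFin n))) ≡⟨ cong length (filter-accept P? P0) ⟩
  suc (length (filter P? (map suc (allFin n))))  ≡⟨ cong suc (length-filter-map P? suc (allFin n)) ⟩
  suc (length (filter (P? ∘ suc) (allFin n)))    ∎
  where open ≡-Reasoning

countFin-< : (v : Fin (suc n)) → countFin (λ (j : Fin n) → j <? v) ≡ toℕ v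
countFin-< {n} v@zero = countFin-none {n} (λ j → j <? v) (λ _ ())
countFin-< {suc n} v@(suc v′) =
  trans (countFin-suc-accept {n} (λ j → j <? v) z<s) (cong suc (trans shift (countFin-< v′)))
  where
  shift : countFin (λ (j : Fin n) → suc j <? v) ≡ countFin (λ (j : Fin n) → j <? v′)
  shift = countFin-cong {n} (λ j → suc j <? v) (λ j → j <? v′) (s<s⁻¹ , s<s)

-- Chosen so that count21 f unfolds to sumFin λ i → countFin (copy21? f i), and likewise for count132.
Copy21 : (Fin n → Fin n) → Fin n → Fin n → Set
Copy21 f i j = (i < j) × (f j < f i)

copy21? : (f : Fin n → Fin n) (i : Fin n) → Decidable (Copy21 f i)
copy21? f i j = (i <? j) ×-dec (f j <? f i)

Copy132 : (Fin n → Fin n) → Fin n → Fin n → Fin n → Set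
Copy132 f i j k = ((i < j) × (j < k)) × ((f i < f k) × (f k < f j))

copy132? : (f : Fin n → Fin n) (i j : Fin n) → Decidable (Copy132 f i j)
copy132? f i j k = ((i <? j) ×-dec (j <? k)) ×-dec ((f i <? f k) ×-dec (f k <? f j))

punchIn-<-⇔ : (v : Fin (suc n)) {i j : Fin n} → punchIn v i < punchIn v j ⇔ i < j
punchIn-<-⇔ v {i} {j} = mk⇔
  (λ lt → ≰⇒> (λ j≤i → <⇒≱ lt (punchIn-mono-≤ v j i j≤i)))
  (λ lt → ≰⇒> (λ vj≤vi → <⇒≱ lt (punchIn-cancel-≤ v j i vj≤vi)))

punchIn<pivot⇔<pivot : (v : Fin (suc n)) (i : Fin n) → punchIn v i < v ⇔ i < v
punchIn<pivot⇔<pivot zero    i       = mk⇔ (λ ()) (λ ())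
punchIn<pivot⇔<pivot (suc v) zero    = mk⇔ (λ _ → z<s) (λ _ → z<s)
punchIn<pivot⇔<pivot (suc v) (suc i) = mk⇔ (s<s ∘ to (punchIn<pivot⇔<pivot v i) ∘ s<s⁻¹)
                                           (s<s ∘ from (punchIn<pivot⇔<pivot v i) ∘ s<s⁻¹)

prepend : Fin (suc n) → Permutation′ n → Permutation′ (suc n)
prepend v q = insert zero v q

prepend-tail-<-⇔ : (v : Fin (suc n)) (q : Permutation′ n) {i j : Fin n} →
                   prepend v q ⟨$⟩ʳ suc i < prepend v q ⟨$⟩ʳ suc j ⇔ q ⟨$⟩ʳ i < q ⟨$⟩ʳ j
prepend-tail-<-⇔ v q {i} {j}
  rewrite insert-punchIn zero v q i | insert-punchIn zero v q j = punchIn-<-⇔ v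

prepend-tail<head⇔ : (v : Fin (suc n)) (q : Permutation′ n) (j : Fin n) →
                     prepend v q ⟨$⟩ʳ suc j < v ⇔ q ⟨$⟩ʳ j < v
prepend-tail<head⇔ v q j rewrite insert-punchIn zero v q j = punchIn<pivot⇔<pivot v (q ⟨$⟩ʳ j)

count21-prepend : (v : Fin (suc n)) (q : Permutation′ n) →
                  count21 (prepend v q ⟨$⟩ʳ_) ≡
                  countFin (λ j → q ⟨$⟩ʳ j <? v) + count21 (q ⟨$⟩ʳ_)
count21-prepend {n} v q = begin
  count21 f
    ≡⟨ sumFin-suc (λ i → countFin (copy21? f i)) ⟩
  countFin (copy21? f zero) + sumFin (λ i → countFin (copy21? f (suc i)))
    ≡⟨ cong₂ _+_ head (sumFin-cong tail) ⟩
  countFin (λ j → g j <? v) + count21 g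
    ∎
  where
  open ≡-Reasoning
  f : Fin (suc n) → Fin (suc n)
  f = prepend v q ⟨$⟩ʳ_
  g : Fin n → Fin n
  g = q ⟨$⟩ʳ_

  head : countFin (copy21? f zero) ≡ countFin (λ j → g j <? v)
  head = trans (countFin-suc-reject (copy21? f zero) (λ { (() , _) }))
               (countFin-cong (copy21? f zero ∘ suc) (λ j → g j <? v)
                  ( (λ { {j} (_ , lt) → to (prepend-tail<head⇔ v q j) lt })
                  , (λ {j} lt → z<s , from (prepend-tail<head⇔ v q j) lt)))

  tail : ∀ i → countFin (copy21? f (suc i)) ≡ countFin (copy21? g i)
  tail i = trans (countFin-suc-reject (copy21? f (suc i)) (λ { (() , _) }))
                 (countFin-cong (copy21? f (suc i) ∘ suc) (copy21? g i)
                    ( (λ (i<j , lt) → s<s⁻¹ i<j , to (prepend-tail-<-⇔ v q) lt)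
                    , (λ (i<j , lt) → s<s i<j , from (prepend-tail-<-⇔ v q) lt)))

count132-prepend : (v : Fin (suc n)) (q : Permutation′ n) →
                   (∀ j k → ¬ Copy132 (prepend v q ⟨$⟩ʳ_) zero (suc j) (suc k)) →
                   count132 (prepend v q ⟨$⟩ʳ_) ≡ count132 (q ⟨$⟩ʳ_)
count132-prepend {n} v q no-head-copy = begin
  count132 f                                     ≡⟨ sumFin-suc copies-from ⟩
  copies-from zero + sumFin (copies-from ∘ suc)  ≡⟨ cong₂ _+_ head (sumFin-cong tail) ⟩
  0 + count132 g                                 ∎
  where
  open ≡-Reasoning
  f : Fin (suc n) → Fin (suc n)
  f = prepend v q ⟨$⟩ʳ_
  g : Fin n → Fin n
  g = q ⟨$⟩ʳ_
  copies-from : Fin (suc n) → ℕ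
  copies-from i = sumFin (λ j → countFin (copy132? f i j))

  no-head-copy′ : ∀ j k → ¬ Copy132 f zero j k
  no-head-copy′ zero    k       ((() , _) , _)
  no-head-copy′ (suc j) zero    ((_ , ()) , _)
  no-head-copy′ (suc j) (suc k) copy = no-head-copy j k copy

  head : copies-from zero ≡ 0
  head = sumFin-zero (λ j → countFin-none (copy132? f zero j) (no-head-copy′ j))

  middle : ∀ i j → countFin (copy132? f (suc i) (suc j)) ≡ countFin (copy132? g i j)
  middle i j = trans (countFin-suc-reject (copy132? f (suc i) (suc j)) (λ { ((_ , ()) , _) }))
    (countFin-cong (copy132? f (suc i) (suc j) ∘ suc) (copy132? g i j)
      ( (λ ((i<j , j<k) , fi<fk , fk<fj) → (s<s⁻¹ i<j , s<s⁻¹ j<k) , to T fi<fk , to T fk<fj)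
      , (λ ((i<j , j<k) , gi<gk , gk<gj) → (s<s i<j , s<s j<k) , from T gi<gk , from T gk<gj)))
    where
    T : ∀ {a b} → f (suc a) < f (suc b) ⇔ g a < g b
    T = prepend-tail-<-⇔ v q

  tail : ∀ i → copies-from (suc i) ≡ sumFin (λ j → countFin (copy132? g i j))
  tail i = begin
    copies-from (suc i)
      ≡⟨ sumFin-suc (λ j → countFin (copy132? f (suc i) j)) ⟩
    countFin (copy132? f (suc i) zero) + sumFin (λ j → countFin (copy132? f (suc i) (suc j)))
      ≡⟨ cong₂ _+_ (countFin-none (copy132? f (suc i) zero) (λ { k ((() , _) , _) }))
                   (sumFin-cong (middle i)) ⟩
    sumFin (λ j → countFin (copy132? g i j))
      ∎

<fromℕ : (i : Fin n) → i < fromℕ n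
<fromℕ zero    = z<s
<fromℕ (suc i) = s<s (<fromℕ i)

count21-increasing : (f : Fin n → Fin n) → (∀ {i j} → i < j → f i < f j) → count21 f ≡ 0
count21-increasing f mono =
  sumFin-zero λ i → countFin-none (copy21? f i) λ j (i<j , fj<fi) → <-asym (mono i<j) fj<fi

count132-increasing : (f : Fin n → Fin n) → (∀ {i j} → i < j → f i < f j) → count132 f ≡ 0
count132-increasing f mono =
  sumFin-zero λ i → sumFin-zero λ j →
    countFin-none (copy132? f i j) λ k ((_ , j<k) , _ , fk<fj) → <-asym (mono j<k) fk<fj

Avoids132WithInversions : ℕ → Permutation′ n → Set
Avoids132WithInversions c p = (count21 (p ⟨$⟩ʳ_) ≡ c) × (count132 (p ⟨$⟩ʳ_) ≡ 0)

prepend-id : (v : Fin (suc n)) → Avoids132WithInversions (toℕ v) (prepend v id)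
prepend-id {n} v =
  inversions , trans (count132-prepend v idₙ no-head-copy) (count132-increasing ι ι-increasing)
  where
  open ≡-Reasoning
  idₙ : Permutation′ n
  idₙ = id
  ι : Fin n → Fin n
  ι = idₙ ⟨$⟩ʳ_
  ι-increasing : ∀ {i j} → i < j → ι i < ι j
  ι-increasing i<j = i<j
  inversions : count21 (prepend v idₙ ⟨$⟩ʳ_) ≡ toℕ v
  inversions = begin
    count21 (prepend v idₙ ⟨$⟩ʳ_)          ≡⟨ count21-prepend v idₙ ⟩
    countFin (λ j → ι j <? v) + count21 ι  ≡⟨ cong₂ _+_ (countFin-< v) (count21-increasing ι ι-increasing) ⟩
    toℕ v + 0                              ≡⟨ +-identityʳ (toℕ v) ⟩
    toℕ v                                  ∎
  no-head-copy : ∀ j k → ¬ Copy132 (prepend v idₙ ⟨$⟩ʳ_) zero (suc j) (suc k)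
  no-head-copy j k ((_ , j<k) , _ , fk<fj) = <-asym (s<s⁻¹ j<k) (to (prepend-tail-<-⇔ v idₙ) fk<fj)

prepend-max : ∀ {c} (q : Permutation′ n) → Avoids132WithInversions c q →
              Avoids132WithInversions (n + c) (prepend (fromℕ n) q)
prepend-max {n} {c} q (q-inversions , q-avoids) =
  inversions , trans (count132-prepend top q no-head-copy) q-avoids
  where
  open ≡-Reasoning
  top : Fin (suc n)
  top = fromℕ n
  g : Fin n → Fin n
  g = q ⟨$⟩ʳ_
  all-below-top : countFin (λ j → g j <? top) ≡ n
  all-below-top = begin
    countFin (λ j → g j <? top)          ≡⟨ countFin-cong (λ j → g j <? top) (λ j → j <? top)
                                                ((λ _ → <fromℕ _) , (λ _ → <fromℕ _)) ⟩
    countFin (λ (j : Fin n) → j <? top)  ≡⟨ countFin-< top ⟩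
    toℕ top                              ≡⟨ toℕ-fromℕ n ⟩
    n                                    ∎
  inversions : count21 (prepend top q ⟨$⟩ʳ_) ≡ n + c
  inversions = trans (count21-prepend top q) (cong₂ _+_ all-below-top q-inversions)
  no-head-copy : ∀ j k → ¬ Copy132 (prepend top q ⟨$⟩ʳ_) zero (suc j) (suc k)
  no-head-copy j k (_ , top<fk , _) = <-asym top<fk (from (prepend-tail<head⇔ top q k) (<fromℕ (g k)))

sucC2 : ∀ n → suc n C 2 ≡ n + n C 2
sucC2 n = trans (sym (nCk+nC[k+1]≡[n+1]C[k+1] n 1)) (cong (_+ n C 2) (nC1≡n n))

avoids132-with-inversions : ∀ n c → c ≤ n C 2 → Σ (Permutation′ n) (Avoids132WithInversions c)
avoids132-with-inversions zero    c c≤0 = id , sym (n≤0⇒n≡0 c≤0) , refl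
avoids132-with-inversions (suc n) c c≤ with c ≤? n
... | yes c≤n = prepend v id , subst (λ x → Avoids132WithInversions x (prepend v id))
                                    (toℕ-fromℕ< (s<s c≤n)) (prepend-id v)
  where
  v : Fin (suc n)
  v = fromℕ< (s<s c≤n)
... | no c≰n with avoids132-with-inversions n (c ∸ n) (m≤n+o⇒m∸n≤o c n (subst (c ≤_) (sucC2 n) c≤))
...   | q , avoids = prepend (fromℕ n) q , subst (λ x → Avoids132WithInversions x (prepend (fromℕ n) q))
                                                (m+[n∸m]≡n (<⇒≤ (≰⇒> c≰n))) (prepend-max q avoids)

lemma2p4 : (n : ℕ) → .{{_ : NonZero n}} → (c : ℕ) → c ≤ n C 2 →
             Σ (Permutation′ n) λ p →
               (count21 (p ⟨$⟩ʳ_) ≡ c) × (count132 (p ⟨$⟩ʳ_) ≡ 0)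
lemma2p4 n c = avoids132-with-inversions n c
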